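{- Let $m,n\in\mathbb{N}$, let $C_1=\{a_1,\dots,a_m\}$ and $C_2=\{b_1,\dots,b_n\}$ be disjoint sets, and consider the chains $\mathfrak{c}_1=(C_1,\le_1)$ and $\mathfrak{c}_2=(C_2,\le_2)$ with $a_i\le_1 a_j\iff i\le j$ and $b_i\le_2 b_j\iff i\le j$. Let $\pi=(\pi_{i,j})_{1\le i\le m,1\le j\le n}$ be a plane partition with $m$ rows, $n$ columns and largest part at most $2$. Define $R_\pi\subseteq C_1\times C_2$ and $S_\pi\subseteq C_2\times C_1$ by \[ a_i\,R_\pi\,b_{n-j+1}\iff \pi_{i,j}=2,\qquad b_{n-j+1}\,S_\pi\,a_i\iff \pi_{i,j}=0, \] for $1\le i\le m$, $1\le j\le n$. Then $(R_\pi,S_\pi)$ is a proper merging of $\mathfrak{c}_1$ and $\mathfrak{c}_2$.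
   Context: A plane partition with $m$ rows, $n$ columns and largest part at most $2$ is an $m\times n$ array $(\pi_{i,j})$ of integers in $\{0,1,2\}$ which is weakly decreasing along each row and along each column. A quasi-order is a reflexive, transitive binary relation. For disjoint quasi-ordered sets $(P,\leftarrow_P)$, $(Q,\leftarrow_Q)$ and relations $R\subseteq P\times Q$, $S\subseteq Q\times P$, define $\leftarrow_{R,S}$ on $P\cup Q$ by: $p\leftarrow_{R,S}q$ iff $p\leftarrow_P q$ or $p\leftarrow_Q q$ or $(p,q)\in R$ or $(p,q)\in S$. $(R,S)$ is a merging of $P$ and $Q$ if $\leftarrow_{R,S}$ is a quasi-order on $P\cup Q$, and a proper merging if additionally $R\cap S^{ -1}=\emptyset$. -}

module Defs where

open import Level using (0ℓ)
open import Data.Nat using (ℕ)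
open import Data.Fin using (Fin; opposite) renaming (_≤_ to _≤ᶠ_)
open import Data.Sum using (_⊎_; inj₁; inj₂)
open import Data.Product using (_×_; Σ)
open import Data.Empty using (⊥)
open import Relation.Binary.PropositionalEquality using (_≡_)
open import Relation.Binary.Core using (Rel; REL)
open import Relation.Binary.Definitions using (Reflexive; Transitive)

record IsQuasiOrder {A : Set} (_←_ : Rel A 0ℓ) : Set where
  field
    refl  : Reflexive _←_
    trans : Transitive _←_

mergedRel : {P Q : Set} → Rel P 0ℓ → Rel Q 0ℓ →
            REL P Q 0ℓ → REL Q P 0ℓ → Rel (P ⊎ Q) 0ℓ
mergedRel _←P_ _←Q_ R S (inj₁ p) (inj₁ p′) = p ←P p′
mergedRel _←P_ _←Q_ R S (inj₂ q) (inj₂ q′) = q ←Q q′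
mergedRel _←P_ _←Q_ R S (inj₁ p) (inj₂ q)  = R p q
mergedRel _←P_ _←Q_ R S (inj₂ q) (inj₁ p)  = S q p

IsMerging : {P Q : Set} → Rel P 0ℓ → Rel Q 0ℓ →
            REL P Q 0ℓ → REL Q P 0ℓ → Set
IsMerging _←P_ _←Q_ R S = IsQuasiOrder (mergedRel _←P_ _←Q_ R S)

IsProperMerging : {P Q : Set} → Rel P 0ℓ → Rel Q 0ℓ →
                  REL P Q 0ℓ → REL Q P 0ℓ → Set
IsProperMerging _←P_ _←Q_ R S =
  IsMerging _←P_ _←Q_ R S × (∀ p q → R p q → S q p → ⊥)

-- Chain on {a_1..a_m} represented as Fin m (0-indexed): a_i ≤ a_j iff i ≤ j.
chain : (m : ℕ) → Rel (Fin m) 0ℓ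
chain m i j = i ≤ᶠ j

record PlanePartition (m n : ℕ) : Set where
  field
    entry   : Fin m → Fin n → Fin 3
    rowDec  : ∀ i j j′ → j ≤ᶠ j′ → entry i j′ ≤ᶠ entry i j
    colDec  : ∀ i i′ j → i ≤ᶠ i′ → entry i′ j ≤ᶠ entry i j

-- a_i R_π b_{n-j+1} iff π_{i,j} = 2 ; with 0-indexing, b_k corresponds to column opposite k.
Rπ : {m n : ℕ} → PlanePartition m n → REL (Fin m) (Fin n) 0ℓ
Rπ π i k = PlanePartition.entry π i (opposite k) ≡ Data.Fin.fromℕ 2

Sπ : {m n : ℕ} → PlanePartition m n → REL (Fin n) (Fin m) 0ℓ
Sπ π k i = PlanePartition.entry π i (opposite k) ≡ Data.Fin.zero

module Submission where

open import Level using (0ℓ)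
open import Data.Nat using (ℕ; suc; z≤n; s≤s)
import Data.Nat as ℕ
open import Data.Nat.Properties using (∸-monoʳ-≤)
open import Data.Fin using (Fin; zero; fromℕ; opposite; _≤_; _≥_)
open import Data.Fin.Properties
  using (≤-antisym; ≤fromℕ; ≤-isTotalOrder; opposite-prop)
open import Data.Sum using (_⊎_; inj₁; inj₂)
open import Data.Product using (_,_)
open import Data.Empty using (⊥; ⊥-elim)
open import Relation.Binary.Core using (Rel; _Preserves_⟶_)
open import Relation.Binary.Structures using (IsTotalPreorder; IsTotalOrder)
open import Relation.Binary.PropositionalEquality
  using (_≡_; _≢_; refl; sym; trans; subst₂)
open import Defs

-- Read the plane partition as a {0,1,2}-valued matrix f(a_i, b_k) that decreases
-- along the first chain and increases along the second, so that R and S are the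
-- level sets {f = 2} and {f = 0}. The first is an up-set and the second a down-set
-- of P × Q ordered by (≥, ≤), so composing R or S with a chain step stays inside R
-- or S. For a composite R;S or S;R the two endpoints are comparable, and the wrong
-- order would force a single entry to be both 2 and 0.

opposite-antimono : ∀ {n} → opposite {n} Preserves _≤_ ⟶ _≥_
opposite-antimono {n} {k} {k′} k≤k′ =
  subst₂ ℕ._≤_ (sym (opposite-prop k′)) (sym (opposite-prop k))
    (∸-monoʳ-≤ n (s≤s k≤k′))

≡fromℕ-upward : ∀ {n} {x y : Fin (suc n)} → x ≤ y → x ≡ fromℕ n → y ≡ fromℕ n
≡fromℕ-upward {y = y} x≤y refl = ≤-antisym (≤fromℕ y) x≤y

≡zero-downward : ∀ {n} {x y : Fin (suc n)} → x ≤ y → y ≡ zero → x ≡ zero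
≡zero-downward x≤y refl = ≤-antisym x≤y z≤n

fromℕ2≢zero : fromℕ 2 ≢ zero {2}
fromℕ2≢zero ()

module _ {P Q : Set} {_≤P_ : Rel P 0ℓ} {_≤Q_ : Rel Q 0ℓ}
         (≤P-isTotalPreorder : IsTotalPreorder _≡_ _≤P_)
         (≤Q-isTotalPreorder : IsTotalPreorder _≡_ _≤Q_)
         (f : P → Q → Fin 3)
         (f-antimonoˡ : ∀ q {p p′} → p ≤P p′ → f p′ q ≤ f p q)
         (f-monoʳ : ∀ p {q q′} → q ≤Q q′ → f p q ≤ f p q′)
  where

  private
    module ≤P = IsTotalPreorder ≤P-isTotalPreorder
    module ≤Q = IsTotalPreorder ≤Q-isTotalPreorder

  Top : P → Q → Set
  Top p q = f p q ≡ fromℕ 2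

  Bottom : Q → P → Set
  Bottom q p = f p q ≡ zero

  Top∩Bottom⁻¹-empty : ∀ p q → Top p q → Bottom q p → ⊥
  Top∩Bottom⁻¹-empty p q top bottom = fromℕ2≢zero (trans (sym top) bottom)

  Top-upˡ : ∀ {p p′ q} → p′ ≤P p → Top p q → Top p′ q
  Top-upˡ {q = q} p′≤p top = ≡fromℕ-upward (f-antimonoˡ q p′≤p) top

  Top-upʳ : ∀ {p q q′} → Top p q → q ≤Q q′ → Top p q′
  Top-upʳ {p} top q≤q′ = ≡fromℕ-upward (f-monoʳ p q≤q′) top

  Bottom-downˡ : ∀ {p p′ q} → Bottom q p → p ≤P p′ → Bottom q p′
  Bottom-downˡ {q = q} bottom p≤p′ = ≡zero-downward (f-antimonoˡ q p≤p′) bottom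

  Bottom-downʳ : ∀ {p q q′} → q′ ≤Q q → Bottom q p → Bottom q′ p
  Bottom-downʳ {p} q′≤q bottom = ≡zero-downward (f-monoʳ p q′≤q) bottom

  private
    _←_ : Rel (P ⊎ Q) 0ℓ
    _←_ = mergedRel _≤P_ _≤Q_ Top Bottom

  ←-refl : ∀ {x} → x ← x
  ←-refl {inj₁ p} = ≤P.refl
  ←-refl {inj₂ q} = ≤Q.refl

  Top-Bottom⇒≤P : ∀ {p p′ q} → Top p q → Bottom q p′ → p ≤P p′
  Top-Bottom⇒≤P {p} {p′} {q} top bottom with ≤P.total p p′
  ... | inj₁ p≤p′ = p≤p′
  ... | inj₂ p′≤p = ⊥-elim (Top∩Bottom⁻¹-empty p′ q (Top-upˡ p′≤p top) bottom)

  Bottom-Top⇒≤Q : ∀ {p q q′} → Bottom q p → Top p q′ → q ≤Q q′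
  Bottom-Top⇒≤Q {p} {q} {q′} bottom top with ≤Q.total q q′
  ... | inj₁ q≤q′ = q≤q′
  ... | inj₂ q′≤q = ⊥-elim (Top∩Bottom⁻¹-empty p q (Top-upʳ top q′≤q) bottom)

  ←-trans : ∀ {x y z} → x ← y → y ← z → x ← z
  ←-trans {inj₁ _} {inj₁ _} {inj₁ _} = ≤P.trans
  ←-trans {inj₁ _} {inj₁ _} {inj₂ _} = Top-upˡ
  ←-trans {inj₁ _} {inj₂ _} {inj₁ _} = Top-Bottom⇒≤P
  ←-trans {inj₁ _} {inj₂ _} {inj₂ _} = Top-upʳ
  ←-trans {inj₂ _} {inj₁ _} {inj₁ _} = Bottom-downˡ
  ←-trans {inj₂ _} {inj₁ _} {inj₂ _} = Bottom-Top⇒≤Q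
  ←-trans {inj₂ _} {inj₂ _} {inj₁ _} = Bottom-downʳ
  ←-trans {inj₂ _} {inj₂ _} {inj₂ _} = ≤Q.trans

  levelSets-isProperMerging : IsProperMerging _≤P_ _≤Q_ Top Bottom
  levelSets-isProperMerging =
    record { refl = λ {x} → ←-refl {x} ; trans = λ {x y z} → ←-trans {x} {y} {z} }
    , Top∩Bottom⁻¹-empty

lemma3p3 : (m n : ℕ) (π : PlanePartition m n) →
    IsProperMerging (chain m) (chain n) (Rπ π) (Sπ π)
lemma3p3 m n π =
  levelSets-isProperMerging ≤-isTotalPreorder ≤-isTotalPreorder
    (λ i k → entry i (opposite k))
    (λ k → colDec _ _ (opposite k))
    (λ i k≤k′ → rowDec i _ _ (opposite-antimono k≤k′))
  where
  open PlanePartition π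
  ≤-isTotalPreorder : ∀ {n} → IsTotalPreorder _≡_ (_≤_ {n})
  ≤-isTotalPreorder = IsTotalOrder.isTotalPreorder ≤-isTotalOrder
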